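{- Let $m\ge 4$ be even, $n$ even, $\ell \in\mathbb{Z}_n$ even and $k \in \mathbb{Z}_n$ odd with $2k\notin\{2,-2\}$, $2k^2\in\{2,-2\}$, such that either (a) $\ell k\in\{\ell,-\ell\}$ and at least one of $k^2\in\{1,-1\}$, $4\mid m$ holds, or (b) $\ell k\in\{n'+\ell,n'-\ell\}$, $m\equiv 2\pmod 4$ and $k^2\in\{n'+1,n'-1\}$, where $n=2n'$. Let $\Gamma = \mathcal{X}_a(m,n,k,\ell)$. Then $\Gamma = \mathcal{X}_a(m,n,-k,\ell)$ and $\Gamma \cong \mathcal{X}_a(m,n,k,-\ell)$. Moreover, if $4 \mid n$, then $\Gamma \cong \mathcal{X}_a(m,n,k+n',\ell)$ if $4 \mid m$, and $\Gamma \cong \mathcal{X}_a(m,n,k+n',\ell+n')$ if $4 \nmid m$.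
   Context: $\mathcal{X}_a(m,n,k,\ell)$ (for $m$ even) is the graph with vertices $u_{i,j}$ ($i\in\mathbb{Z}_m$, $j\in\mathbb{Z}_n$) and edges: $u_{i,j}u_{i,j+1}$ for even $i$ and $u_{i,j}u_{i,j+k}$ for odd $i$ (all $j$); $u_{i,j}u_{i+1,j}$ for integers $0\le i\le m-2$ and $j\equiv i\pmod 2$; $u_{m-1,j}u_{0,j+\ell}$ for odd $j$. Arithmetic in $\mathbb{Z}_n$. -}

module Defs where

open import Data.Nat using (ℕ; zero; suc; _+_; _*_; _∸_; _<_; NonZero)
open import Data.Nat.DivMod using (_%_)
open import Data.Fin using (Fin; toℕ)
open import Data.Product using (_×_; _,_)
open import Data.Sum using (_⊎_)
open import Relation.Binary.PropositionalEquality using (_≡_)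
open import Function.Bundles using (_↔_; _⇔_; Inverse)

Vertex : ℕ → ℕ → Set
Vertex m n = Fin m × Fin n

infix 4 _≡[_]_
_≡[_]_ : ℕ → (n : ℕ) → .{{NonZero n}} → ℕ → Set
a ≡[ n ] b = a % n ≡ b % n

-- The generating (directed) edge list of X_a(m,n,k,ℓ); k, ℓ are natural
-- representatives of elements of ℤ_n.
data Gen (m n k ℓ : ℕ) .{{_ : NonZero n}} : Vertex m n → Vertex m n → Set where
  evenRow : ∀ i j j' → toℕ i % 2 ≡ 0 → toℕ j' ≡ (toℕ j + 1) % n →
            Gen m n k ℓ (i , j) (i , j')
  oddRow  : ∀ i j j' → toℕ i % 2 ≡ 1 → toℕ j' ≡ (toℕ j + k) % n →
            Gen m n k ℓ (i , j) (i , j')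
  spoke   : ∀ i i' j → suc (toℕ i) < m → toℕ i' ≡ suc (toℕ i) →
            toℕ j % 2 ≡ toℕ i % 2 →
            Gen m n k ℓ (i , j) (i' , j)
  wrap    : ∀ i i' j j' → suc (toℕ i) ≡ m → toℕ i' ≡ 0 → toℕ j % 2 ≡ 1 →
            toℕ j' ≡ (toℕ j + ℓ) % n →
            Gen m n k ℓ (i , j) (i' , j')

Xa : (m n k ℓ : ℕ) → .{{NonZero n}} → Vertex m n → Vertex m n → Set
Xa m n k ℓ u v = Gen m n k ℓ u v ⊎ Gen m n k ℓ v u

SameGraph : {V : Set} → (V → V → Set) → (V → V → Set) → Set
SameGraph {V} E F = ∀ (u v : V) → E u v ⇔ F u v

record Iso {V : Set} (E F : V → V → Set) : Set where
  field
    bij      : V ↔ V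
    preserve : ∀ u v → E u v ⇔ F (Inverse.to bij u) (Inverse.to bij v)

-- All three identifications are realised by vertex maps that fix every row.
-- Replacing k by -k does not change the edge set, since the odd-row edge {j, j + k}
-- is also {j + k, (j + k) - k}.  The reflection j ↦ -j in every row turns ℓ into -ℓ:
-- row edges are reversed, spokes keep their parity condition because n is even, and
-- the wrap-around edge j → j + ℓ becomes -j → -j - ℓ.  When 4 ∣ n put h = n/2 and move
-- column j of row i to j + h s(i, j), where s(i, j) = ⌊i/2⌋ + [i and j odd]; as h is
-- even this preserves parities and is an involution.  Spokes join vertices with equal
-- shifts, even rows move rigidly, an odd-row edge j → j + k becomes j' → j' + k + h, and
-- the wrap-around edges from row m - 1 (shift h m/2) to row 0 (shift 0) turn ℓ into
-- ℓ + h m/2, that is ℓ if 4 ∣ m and ℓ + h otherwise.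
module Submission where

open import Defs
open import Algebra.Properties.CommutativeSemigroup using (x∙yz≈y∙xz)
open import Data.Empty using (⊥-elim)
open import Data.Fin using (Fin; toℕ)
open import Data.Fin.Properties using (toℕ-fromℕ<; toℕ-injective; toℕ<n)
open import Data.List using ([]; _∷_)
open import Data.Nat using (ℕ; zero; suc; _+_; _*_; _∸_; _≤_; NonZero; ⌊_/2⌋)
open import Data.Nat.DivMod
open import Data.Nat.Divisibility
  using (_∣_; divides-refl; m*n∣o⇒m∣o/n; n∣m⇒m%n≡0; m%n≡0⇒n∣m; ∣m∣n⇒∣m+n; ∣m⇒∣m*n;
         *-monoˡ-∣; *-cancelʳ-∣)
open import Data.Nat.Properties
  using (+-comm; +-assoc; +-identityʳ; +-suc; *-zeroʳ; *-identityʳ; *-suc; <⇒≤; m+[n∸m]≡n;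
         +-commutativeSemigroup)
open import Data.Nat.Tactic.RingSolver using (solve)
open import Data.Product using (_×_; _,_)
open import Data.Sum using (_⊎_; inj₁; inj₂; swap)
open import Function.Base using (id; _∘_)
open import Function.Bundles using (mk⇔; mk↔ₛ′)
open import Relation.Binary.Bundles using (Setoid)
import Relation.Binary.Construct.On as On
import Relation.Binary.Reasoning.Setoid
open import Relation.Binary.PropositionalEquality
open import Relation.Nullary using (¬_)

-- Xa m n k ℓ unfolds to Undirected (Gen m n k ℓ).
Undirected : {V : Set} → (V → V → Set) → V → V → Set
Undirected G u v = G u v ⊎ G v u

Undirected-map : {V : Set} {G H : V → V → Set} (φ : V → V) →
                 (∀ {u v} → G u v → Undirected H (φ u) (φ v)) →
                 ∀ {u v} → Undirected G u v → Undirected H (φ u) (φ v)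
Undirected-map φ edge (inj₁ e) = edge e
Undirected-map φ edge (inj₂ e) = swap (edge e)

module _ {V : Set} {G H : V → V → Set} where

  Undirected-sameGraph : (∀ {u v} → G u v → Undirected H u v) →
                         (∀ {u v} → H u v → Undirected G u v) →
                         SameGraph (Undirected G) (Undirected H)
  Undirected-sameGraph G⇒H H⇒G u v =
    mk⇔ (Undirected-map {H = H} id G⇒H) (Undirected-map {H = G} id H⇒G)

  involution⇒Iso : (φ : V → V) → (∀ u → φ (φ u) ≡ u) →
                   (∀ {u v} → G u v → Undirected H (φ u) (φ v)) →
                   (∀ {u v} → H u v → Undirected G (φ u) (φ v)) →
                   Iso (Undirected G) (Undirected H)
  involution⇒Iso φ φ∘φ≡id G⇒H H⇒G = record
    { bij      = mk↔ₛ′ φ φ φ∘φ≡id φ∘φ≡id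
    ; preserve = λ u v → mk⇔ (Undirected-map {H = H} φ G⇒H)
                   (subst₂ (Undirected G) (φ∘φ≡id u) (φ∘φ≡id v) ∘ Undirected-map {H = G} φ H⇒G)
    }

≡[]-weaken : ∀ {a b n} d .{{_ : NonZero n}} .{{_ : NonZero d}} →
             d ∣ n → a ≡[ n ] b → a ≡[ d ] b
≡[]-weaken {a} {b} {n} d d∣n a≈b =
  trans (sym (m∣n⇒o%n%m≡o%m d n a d∣n)) (trans (cong (_% d) a≈b) (m∣n⇒o%n%m≡o%m d n b d∣n))

module Modular (n : ℕ) .{{_ : NonZero n}} where

  infix 4 _≈_
  _≈_ : ℕ → ℕ → Set
  a ≈ b = a ≡[ n ] b

  ≈-setoid : Setoid _ _
  ≈-setoid = On.setoid (setoid ℕ) (_% n)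

  module ≈-Reasoning = Relation.Binary.Reasoning.Setoid ≈-setoid
  open ≈-Reasoning

  ≡⇒≈ : ∀ {a b} → a ≡ b → a ≈ b
  ≡⇒≈ = cong (_% n)

  %-≈ : ∀ a → a % n ≈ a
  %-≈ a = m%n%n≡m%n a n

  *n≈0 : ∀ q → q * n ≈ 0
  *n≈0 q = trans (m*n%n≡0 q n) (sym (m*n%n≡0 0 n))

  n≈0 : n ≈ 0
  n≈0 = trans (n%n≡0 n) (sym (m*n%n≡0 0 n))

  +-cong : ∀ {a b c d} → a ≈ b → c ≈ d → a + c ≈ b + d
  +-cong {a} {b} {c} {d} a≈b c≈d = begin
    a + c         ≈⟨ %-distribˡ-+ a c n ⟩
    a % n + c % n ≡⟨ cong₂ _+_ a≈b c≈d ⟩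
    b % n + d % n ≈⟨ %-distribˡ-+ b d n ⟨
    b + d         ∎

  +-congˡ : ∀ a {b c} → b ≈ c → a + b ≈ a + c
  +-congˡ a = +-cong {a} {a} refl

  +-congʳ : ∀ {a b} c → a ≈ b → a + c ≈ b + c
  +-congʳ c a≈b = +-cong a≈b (refl {x = c % n})

  +-∸≈0 : ∀ {a} → a ≤ n → a + (n ∸ a) ≈ 0
  +-∸≈0 a≤n = trans (≡⇒≈ (m+[n∸m]≡n a≤n)) n≈0

  +-transpose : ∀ {x c y c'} → x + c ≈ y → c + c' ≈ 0 → y + c' ≈ x
  +-transpose {x} {c} {y} {c'} x+c≈y c+c'≈0 = begin
    y + c'       ≈⟨ +-congʳ c' x+c≈y ⟨
    x + c + c'   ≡⟨ +-assoc x c c' ⟩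
    x + (c + c') ≈⟨ +-congˡ x c+c'≈0 ⟩
    x + 0        ≡⟨ +-identityʳ x ⟩
    x            ∎

  +-inverse-unique : ∀ {x a b} → x + a ≈ 0 → x + b ≈ 0 → a ≈ b
  +-inverse-unique {x} {a} {b} x+a≈0 x+b≈0 = begin
    a           ≡⟨ +-identityʳ a ⟨
    a + 0       ≈⟨ +-congˡ a x+b≈0 ⟨
    a + (x + b) ≡⟨ solve (a ∷ x ∷ b ∷ []) ⟩
    x + a + b   ≈⟨ +-congʳ b x+a≈0 ⟩
    b           ∎

  negate-step : ∀ {x x̂ y ŷ c} → x + x̂ ≈ 0 → y + ŷ ≈ 0 → x + c ≈ y → ŷ + c ≈ x̂
  negate-step {x} {x̂} {y} {ŷ} {c} x+x̂≈0 y+ŷ≈0 x+c≈y = begin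
    ŷ + c             ≡⟨ +-identityʳ (ŷ + c) ⟨
    ŷ + c + 0         ≈⟨ +-congˡ (ŷ + c) x+x̂≈0 ⟨
    ŷ + c + (x + x̂)   ≡⟨ solve (ŷ ∷ c ∷ x ∷ x̂ ∷ []) ⟩
    ŷ + (x + c) + x̂   ≈⟨ +-congʳ x̂ (+-congˡ ŷ x+c≈y) ⟩
    ŷ + y + x̂         ≡⟨ cong (_+ x̂) (+-comm ŷ y) ⟩
    y + ŷ + x̂         ≈⟨ +-congʳ x̂ y+ŷ≈0 ⟩
    x̂                 ∎

  translate-step : ∀ {x x̂ y ŷ s t c c'} → x + s ≈ x̂ → y + t ≈ ŷ → x + c ≈ y →
                   s + c' ≈ c + t → x̂ + c' ≈ ŷ
  translate-step {x} {x̂} {y} {ŷ} {s} {t} {c} {c'} x+s≈x̂ y+t≈ŷ x+c≈y s+c'≈c+t = begin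
    x̂ + c'       ≈⟨ +-congʳ c' x+s≈x̂ ⟨
    x + s + c'   ≡⟨ +-assoc x s c' ⟩
    x + (s + c') ≈⟨ +-congˡ x s+c'≈c+t ⟩
    x + (c + t)  ≡⟨ +-assoc x c t ⟨
    x + c + t    ≈⟨ +-congʳ t x+c≈y ⟩
    y + t        ≈⟨ y+t≈ŷ ⟩
    ŷ            ∎

  ≡%⇒≈ : ∀ {a b} → a ≡ b % n → b ≈ a
  ≡%⇒≈ {a} {b} a≡b%n = sym (trans (cong (_% n) a≡b%n) (%-≈ b))

  ≈⇒≡% : ∀ {b} (x : Fin n) → b ≈ toℕ x → toℕ x ≡ b % n
  ≈⇒≡% x b≈x = trans (sym (m<n⇒m%n≡m (toℕ<n x))) (sym b≈x)

  toℕ-≈⇒≡ : ∀ {x y : Fin n} → toℕ x ≈ toℕ y → x ≡ y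
  toℕ-≈⇒≡ {x} {y} x≈y = toℕ-injective (trans (≈⇒≡% x (sym x≈y)) (m<n⇒m%n≡m (toℕ<n y)))

  toℕ-mod : ∀ a → toℕ (a mod n) ≈ a
  toℕ-mod a = trans (cong (_% n) (toℕ-fromℕ< (m%n<n a n))) (%-≈ a)

module M₂ = Modular 2

m+m≡[2]0 : ∀ a → a + a ≡[ 2 ] 0
m+m≡[2]0 a = trans (cong (_% 2) a+a≡a*2) (m*n%n≡0 a 2)
  where
  a+a≡a*2 : a + a ≡ a * 2
  a+a≡a*2 = solve (a ∷ [])

odd-step-flips-parity : ∀ {n a b k} .{{_ : NonZero n}} → 2 ∣ n → k % 2 ≡ 1 →
                        a + k ≡[ n ] b → suc (a % 2) ≡[ 2 ] b % 2
odd-step-flips-parity {n} {a} {b} {k} 2∣n k-odd a+k≈b =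
  trans (M₂.+-congˡ 1 {a % 2} {a} (M₂.%-≈ a)) (trans (cong (_% 2) (+-comm 1 a))
    (trans (M₂.+-congˡ a {1} {k} (sym k-odd))
      (trans (≡[]-weaken 2 2∣n a+k≈b) (sym (M₂.%-≈ b)))))

2∣suc⇒odd : ∀ {i} → 2 ∣ suc i → i % 2 ≡ 1
2∣suc⇒odd {i} 2∣1+i = sym (M₂.+-transpose {i} {1} {0} {1} i+1≡[2]0 refl)
  where
  i+1≡[2]0 : i + 1 ≡[ 2 ] 0
  i+1≡[2]0 = trans (cong (_% 2) (+-comm i 1)) (n∣m⇒m%n≡0 (suc i) 2 2∣1+i)

module _ (m n : ℕ) .{{_ : NonZero n}} where
  open Modular n

  reverse-oddRows : ∀ {k k' ℓ u v} → k + k' ≈ 0 →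
                    Gen m n k ℓ u v → Undirected (Gen m n k' ℓ) u v
  reverse-oddRows k+k'≈0 (evenRow i j j' i-even j+1≈j') = inj₁ (evenRow i j j' i-even j+1≈j')
  reverse-oddRows k+k'≈0 (oddRow i j j' i-odd j+k≈j') =
    inj₂ (oddRow i j' j i-odd (≈⇒≡% j (+-transpose (≡%⇒≈ j+k≈j') k+k'≈0)))
  reverse-oddRows k+k'≈0 (spoke i i' j i<m i'≡1+i j≡i) = inj₁ (spoke i i' j i<m i'≡1+i j≡i)
  reverse-oddRows k+k'≈0 (wrap i i' j j' 1+i≡m i'≡0 j-odd j+ℓ≈j') =
    inj₁ (wrap i i' j j' 1+i≡m i'≡0 j-odd j+ℓ≈j')

  Xa-sameGraph : ∀ {k k' ℓ} → k + k' ≈ 0 → SameGraph (Xa m n k ℓ) (Xa m n k' ℓ)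
  Xa-sameGraph {k} {k'} k+k'≈0 =
    Undirected-sameGraph (reverse-oddRows k+k'≈0)
                         (reverse-oddRows (trans (≡⇒≈ (+-comm k' k)) k+k'≈0))

module Reflection (m n : ℕ) .{{_ : NonZero n}} (2∣n : 2 ∣ n) where
  open Modular n

  negate : Fin n → Fin n
  negate j = (n ∸ toℕ j) mod n

  negate-inverse : ∀ j → toℕ j + toℕ (negate j) ≈ 0
  negate-inverse j = trans (+-congˡ (toℕ j) (toℕ-mod (n ∸ toℕ j))) (+-∸≈0 (<⇒≤ (toℕ<n j)))

  negate-involutive : ∀ j → negate (negate j) ≡ j
  negate-involutive j = toℕ-≈⇒≡
    (+-inverse-unique (negate-inverse (negate j))
                      (trans (≡⇒≈ (+-comm (toℕ (negate j)) (toℕ j))) (negate-inverse j)))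

  negate-parity : ∀ j → toℕ (negate j) % 2 ≡ toℕ j % 2
  negate-parity j =
    M₂.+-inverse-unique {toℕ j} (≡[]-weaken 2 2∣n (negate-inverse j)) (m+m≡[2]0 (toℕ j))

  reflect : Vertex m n → Vertex m n
  reflect (i , j) = i , negate j

  reflect-involutive : ∀ u → reflect (reflect u) ≡ u
  reflect-involutive (i , j) = cong (i ,_) (negate-involutive j)

  reflect-edge : ∀ {k ℓ ℓ' u v} → ℓ + ℓ' ≈ 0 →
                 Gen m n k ℓ u v → Undirected (Gen m n k ℓ') (reflect u) (reflect v)
  reflect-edge _ (evenRow i j j' i-even j+1≈j') =
    inj₂ (evenRow i (negate j') (negate j) i-even (≈⇒≡% (negate j)
      (negate-step (negate-inverse j) (negate-inverse j') (≡%⇒≈ j+1≈j'))))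
  reflect-edge _ (oddRow i j j' i-odd j+k≈j') =
    inj₂ (oddRow i (negate j') (negate j) i-odd (≈⇒≡% (negate j)
      (negate-step (negate-inverse j) (negate-inverse j') (≡%⇒≈ j+k≈j'))))
  reflect-edge _ (spoke i i' j i<m i'≡1+i j≡i) =
    inj₁ (spoke i i' (negate j) i<m i'≡1+i (trans (negate-parity j) j≡i))
  reflect-edge {ℓ = ℓ} ℓ+ℓ'≈0 (wrap i i' j j' 1+i≡m i'≡0 j-odd j+ℓ≈j') =
    inj₁ (wrap i i' (negate j) (negate j') 1+i≡m i'≡0 (trans (negate-parity j) j-odd)
      (≈⇒≡% (negate j') (+-transpose {c = ℓ}
        (negate-step (negate-inverse j) (negate-inverse j') (≡%⇒≈ j+ℓ≈j')) ℓ+ℓ'≈0)))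

  reflectIso : ∀ {k ℓ ℓ'} → ℓ + ℓ' ≈ 0 → Iso (Xa m n k ℓ) (Xa m n k ℓ')
  reflectIso {ℓ = ℓ} {ℓ'} ℓ+ℓ'≈0 = involution⇒Iso reflect reflect-involutive
    (reflect-edge ℓ+ℓ'≈0) (reflect-edge (trans (≡⇒≈ (+-comm ℓ' ℓ)) ℓ+ℓ'≈0))

-- rowShift i b = ⌊ i /2⌋ + b for odd i and ⌊ i /2⌋ for even i, b being a column parity.
rowShift : ℕ → ℕ → ℕ
rowShift zero          b = 0
rowShift (suc zero)    b = b
rowShift (suc (suc i)) b = suc (rowShift i b)

rowShift-even : ∀ i {b b'} → i % 2 ≡ 0 → rowShift i b ≡ rowShift i b'
rowShift-even zero          _      = refl
rowShift-even (suc (suc i)) i-even = cong suc (rowShift-even i i-even)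

rowShift-odd : ∀ i b → i % 2 ≡ 1 → rowShift i b ≡ b + rowShift i 0
rowShift-odd (suc zero)    b _     = sym (+-identityʳ b)
rowShift-odd (suc (suc i)) b i-odd = trans (cong suc (rowShift-odd i b i-odd)) (sym (+-suc b _))

rowShift-spoke : ∀ i b → b ≡ i % 2 → rowShift i b ≡ rowShift (suc i) b
rowShift-spoke zero          _ refl = refl
rowShift-spoke (suc zero)    _ refl = refl
rowShift-spoke (suc (suc i)) b b≡i  = cong suc (rowShift-spoke i b b≡i)

rowShift-last : ∀ i → i % 2 ≡ 1 → rowShift i 1 ≡ ⌊ suc i /2⌋
rowShift-last (suc zero)    _     = refl
rowShift-last (suc (suc i)) i-odd = cong suc (rowShift-last i i-odd)

parity : ∀ a → a % 2 ≡ 0 ⊎ a % 2 ≡ 1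
parity zero          = inj₁ refl
parity (suc zero)    = inj₂ refl
parity (suc (suc a)) = parity a

⌊n*2/2⌋≡n : ∀ n → ⌊ n * 2 /2⌋ ≡ n
⌊n*2/2⌋≡n zero    = refl
⌊n*2/2⌋≡n (suc n) = cong suc (⌊n*2/2⌋≡n n)

4∣⇒⌊/2⌋-even : ∀ {m} → 2 ∣ m → 4 ∣ m → ⌊ m /2⌋ % 2 ≡ 0
4∣⇒⌊/2⌋-even (divides-refl t) 4∣m rewrite ⌊n*2/2⌋≡n t = n∣m⇒m%n≡0 t 2 (*-cancelʳ-∣ 2 4∣m)

4∤⇒⌊/2⌋-odd : ∀ {m} → 2 ∣ m → ¬ 4 ∣ m → ⌊ m /2⌋ % 2 ≡ 1
4∤⇒⌊/2⌋-odd (divides-refl t) 4∤m rewrite ⌊n*2/2⌋≡n t with parity t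
... | inj₂ t-odd  = t-odd
... | inj₁ t-even = ⊥-elim (4∤m (*-monoˡ-∣ 2 (m%n≡0⇒n∣m t 2 t-even)))

module Twist (m n h : ℕ) .{{_ : NonZero n}}
             (2∣m : 2 ∣ m) (h+h≡n : h + h ≡ n) (2∣h : 2 ∣ h) where
  open Modular n
  open ≈-Reasoning

  private
    2∣n : 2 ∣ n
    2∣n = subst (2 ∣_) h+h≡n (∣m∣n⇒∣m+n 2∣h 2∣h)

  h*-absorb : ∀ r q → h * (r + q * 2) ≈ h * r
  h*-absorb r q = begin
    h * (r + q * 2)     ≡⟨ solve (h ∷ r ∷ q ∷ []) ⟩
    h * r + q * (h + h) ≡⟨ cong (λ x → h * r + q * x) h+h≡n ⟩
    h * r + q * n       ≈⟨ +-congˡ (h * r) (*n≈0 q) ⟩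
    h * r + 0           ≡⟨ +-identityʳ (h * r) ⟩
    h * r               ∎

  h*-resp-≡[2] : ∀ {a b} → a ≡[ 2 ] b → h * a ≈ h * b
  h*-resp-≡[2] {a} {b} a≡b = begin
    h * a                   ≡⟨ cong (h *_) (m≡m%n+[m/n]*n a 2) ⟩
    h * (a % 2 + a / 2 * 2) ≈⟨ h*-absorb (a % 2) (a / 2) ⟩
    h * (a % 2)             ≡⟨ cong (h *_) a≡b ⟩
    h * (b % 2)             ≈⟨ h*-absorb (b % 2) (b / 2) ⟨
    h * (b % 2 + b / 2 * 2) ≡⟨ cong (h *_) (m≡m%n+[m/n]*n b 2) ⟨
    h * b                   ∎

  h*+h*≈0 : ∀ r → h * r + h * r ≈ 0
  h*+h*≈0 r = begin
    h * r + h * r ≡⟨ solve (h ∷ r ∷ []) ⟩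
    r * (h + h)   ≡⟨ cong (r *_) h+h≡n ⟩
    r * n         ≈⟨ *n≈0 r ⟩
    0             ∎

  shift : Fin m → Fin n → ℕ
  shift i j = h * rowShift (toℕ i) (toℕ j % 2)

  twistColumn : Fin m → Fin n → Fin n
  twistColumn i j = (toℕ j + shift i j) mod n

  twist : Vertex m n → Vertex m n
  twist (i , j) = i , twistColumn i j

  twistColumn-≈ : ∀ i j → toℕ j + shift i j ≈ toℕ (twistColumn i j)
  twistColumn-≈ i j = sym (toℕ-mod (toℕ j + shift i j))

  twistColumn-parity : ∀ i j → toℕ (twistColumn i j) % 2 ≡ toℕ j % 2
  twistColumn-parity i j = trans (cong (_% 2) (toℕ-fromℕ< (m%n<n (toℕ j + shift i j) n)))
    (trans (m∣n⇒o%n%m≡o%m 2 n (toℕ j + shift i j) 2∣n)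
           (%-remove-+ʳ (toℕ j) (∣m⇒∣m*n (rowShift (toℕ i) (toℕ j % 2)) 2∣h)))

  twist-involutive : ∀ u → twist (twist u) ≡ u
  twist-involutive (i , j) = cong (i ,_) (toℕ-≈⇒≡ (begin
    toℕ (twistColumn i ĵ)          ≈⟨ twistColumn-≈ i ĵ ⟨
    toℕ ĵ + shift i ĵ              ≡⟨ cong (λ b → toℕ ĵ + h * rowShift (toℕ i) b)
                                            (twistColumn-parity i j) ⟩
    toℕ ĵ + shift i j              ≈⟨ +-congʳ (shift i j) (twistColumn-≈ i j) ⟨
    toℕ j + shift i j + shift i j  ≡⟨ +-assoc (toℕ j) (shift i j) (shift i j) ⟩
    toℕ j + (shift i j + shift i j) ≈⟨ +-congˡ (toℕ j) (h*+h*≈0 _) ⟩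
    toℕ j + 0                      ≡⟨ +-identityʳ (toℕ j) ⟩
    toℕ j                          ∎))
    where
    ĵ : Fin n
    ĵ = twistColumn i j

  shift-oddRow : ∀ i j j' {k} → toℕ i % 2 ≡ 1 → k % 2 ≡ 1 → toℕ j + k ≈ toℕ j' →
                 shift i j + h ≈ shift i j'
  shift-oddRow i j j' {k} i-odd k-odd j+k≈j' = begin
    shift i j + h              ≡⟨ cong (λ x → h * x + h) (rowShift-odd (toℕ i) b i-odd) ⟩
    h * (b + R) + h            ≡⟨ trans (+-comm (h * (b + R)) h) (sym (*-suc h (b + R))) ⟩
    h * (suc b + R)            ≈⟨ h*-resp-≡[2] (M₂.+-congʳ {suc b} {b'} R
                                    (odd-step-flips-parity {a = toℕ j} {k = k} 2∣n k-odd j+k≈j')) ⟩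
    h * (b' + R)               ≡⟨ cong (h *_) (rowShift-odd (toℕ i) b' i-odd) ⟨
    shift i j'                 ∎
    where
    b b' R : ℕ
    b  = toℕ j % 2
    b' = toℕ j' % 2
    R  = rowShift (toℕ i) 0

  shift-spoke : ∀ i i' j → toℕ i' ≡ suc (toℕ i) → toℕ j % 2 ≡ toℕ i % 2 → shift i j ≡ shift i' j
  shift-spoke i i' j i'≡1+i j≡i = cong (h *_)
    (trans (rowShift-spoke (toℕ i) (toℕ j % 2) j≡i)
           (cong (λ x → rowShift x (toℕ j % 2)) (sym i'≡1+i)))

  shift-firstRow : ∀ i j → toℕ i ≡ 0 → shift i j ≡ 0
  shift-firstRow i j i≡0 = trans (cong (λ x → h * rowShift x (toℕ j % 2)) i≡0) (*-zeroʳ h)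

  shift-lastRow : ∀ i j → suc (toℕ i) ≡ m → toℕ j % 2 ≡ 1 → shift i j ≡ h * ⌊ m /2⌋
  shift-lastRow i j 1+i≡m j-odd = cong (h *_)
    (trans (cong (rowShift (toℕ i)) j-odd)
           (trans (rowShift-last (toℕ i) i-odd) (cong ⌊_/2⌋ 1+i≡m)))
    where
    i-odd : toℕ i % 2 ≡ 1
    i-odd = 2∣suc⇒odd (subst (2 ∣_) (sym 1+i≡m) 2∣m)

  twist-edge : ∀ {k k' ℓ ℓ' u v} → k % 2 ≡ 1 → k + h ≈ k' → h * ⌊ m /2⌋ + ℓ' ≈ ℓ →
               Gen m n k ℓ u v → Gen m n k' ℓ' (twist u) (twist v)
  twist-edge _ _ _ (evenRow i j j' i-even j+1≈j') =
    evenRow i (twistColumn i j) (twistColumn i j') i-even (≈⇒≡% (twistColumn i j')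
      (translate-step (twistColumn-≈ i j) (twistColumn-≈ i j') (≡%⇒≈ j+1≈j')
        (≡⇒≈ (trans (+-comm (shift i j) 1)
                    (cong (λ r → 1 + h * r) (rowShift-even (toℕ i) i-even))))))
  twist-edge {k} {k'} k-odd k+h≈k' _ (oddRow i j j' i-odd j+k≈j') =
    oddRow i (twistColumn i j) (twistColumn i j') i-odd (≈⇒≡% (twistColumn i j')
      (translate-step (twistColumn-≈ i j) (twistColumn-≈ i j') (≡%⇒≈ j+k≈j') (begin
        shift i j + k'      ≈⟨ +-congˡ (shift i j) k+h≈k' ⟨
        shift i j + (k + h) ≡⟨ x∙yz≈y∙xz +-commutativeSemigroup (shift i j) k h ⟩
        k + (shift i j + h) ≈⟨ +-congˡ k (shift-oddRow i j j' i-odd k-odd (≡%⇒≈ j+k≈j')) ⟩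
        k + shift i j'      ∎)))
  twist-edge {k' = k'} {ℓ' = ℓ'} _ _ _ (spoke i i' j i<m i'≡1+i j≡i) =
    subst (λ ĵ → Gen m n k' ℓ' (i , twistColumn i j) (i' , ĵ))
      (cong (λ s → (toℕ j + s) mod n) (shift-spoke i i' j i'≡1+i j≡i))
      (spoke i i' (twistColumn i j) i<m i'≡1+i (trans (twistColumn-parity i j) j≡i))
  twist-edge {ℓ = ℓ} {ℓ'} _ _ w+ℓ'≈ℓ (wrap i i' j j' 1+i≡m i'≡0 j-odd j+ℓ≈j') =
    wrap i i' (twistColumn i j) (twistColumn i' j') 1+i≡m i'≡0
      (trans (twistColumn-parity i j) j-odd)
      (≈⇒≡% (twistColumn i' j')
        (translate-step (twistColumn-≈ i j) (twistColumn-≈ i' j') (≡%⇒≈ j+ℓ≈j') (begin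
          shift i j + ℓ'   ≡⟨ cong (_+ ℓ') (shift-lastRow i j 1+i≡m j-odd) ⟩
          h * ⌊ m /2⌋ + ℓ' ≈⟨ w+ℓ'≈ℓ ⟩
          ℓ                ≡⟨ +-identityʳ ℓ ⟨
          ℓ + 0            ≡⟨ cong (ℓ +_) (shift-firstRow i' j' i'≡0) ⟨
          ℓ + shift i' j'  ∎)))

  twistIso : ∀ {k k' ℓ ℓ'} → k % 2 ≡ 1 → k + h ≈ k' → ℓ + h * ⌊ m /2⌋ ≈ ℓ' →
             Iso (Xa m n k ℓ) (Xa m n k' ℓ')
  twistIso {k} {k'} {ℓ} {ℓ'} k-odd k+h≈k' ℓ+w≈ℓ' = involution⇒Iso twist twist-involutive
    (λ e → inj₁ (twist-edge k-odd k+h≈k' w+ℓ'≈ℓ e))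
    (λ e → inj₁ (twist-edge k'-odd (+-transpose k+h≈k' h+h≈0) w+ℓ≈ℓ' e))
    where
    w : ℕ
    w = h * ⌊ m /2⌋
    h+h≈0 : h + h ≈ 0
    h+h≈0 = trans (≡⇒≈ h+h≡n) n≈0
    w+ℓ≈ℓ' : w + ℓ ≈ ℓ'
    w+ℓ≈ℓ' = trans (≡⇒≈ (+-comm w ℓ)) ℓ+w≈ℓ'
    w+ℓ'≈ℓ : w + ℓ' ≈ ℓ
    w+ℓ'≈ℓ = trans (≡⇒≈ (+-comm w ℓ')) (+-transpose ℓ+w≈ℓ' (h*+h*≈0 ⌊ m /2⌋))
    k'-odd : k' % 2 ≡ 1
    k'-odd = trans (sym (≡[]-weaken 2 2∣n k+h≈k')) (trans (%-remove-+ʳ k 2∣h) k-odd)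

  h*⌊m/2⌋≈0 : 4 ∣ m → h * ⌊ m /2⌋ ≈ 0
  h*⌊m/2⌋≈0 4∣m =
    trans (h*-resp-≡[2] {b = 0} (4∣⇒⌊/2⌋-even 2∣m 4∣m)) (≡⇒≈ (*-zeroʳ h))

  h*⌊m/2⌋≈h : ¬ 4 ∣ m → h * ⌊ m /2⌋ ≈ h
  h*⌊m/2⌋≈h 4∤m =
    trans (h*-resp-≡[2] {b = 1} (4∤⇒⌊/2⌋-odd 2∣m 4∤m)) (≡⇒≈ (*-identityʳ h))

lemma7p1 : (m n : ℕ) → .{{_ : NonZero n}} → (k ℓ : Fin n) →
    4 ≤ m → 2 ∣ m → 2 ∣ n → toℕ ℓ % 2 ≡ 0 → toℕ k % 2 ≡ 1 →
    ¬ (2 * toℕ k ≡[ n ] 2) → ¬ (2 * toℕ k + 2 ≡[ n ] 0) →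
    ((2 * toℕ k * toℕ k ≡[ n ] 2) ⊎ (2 * toℕ k * toℕ k + 2 ≡[ n ] 0)) →
    ((((toℕ ℓ * toℕ k ≡[ n ] toℕ ℓ) ⊎ (toℕ ℓ * toℕ k + toℕ ℓ ≡[ n ] 0))
      × (((toℕ k * toℕ k ≡[ n ] 1) ⊎ (toℕ k * toℕ k + 1 ≡[ n ] 0)) ⊎ (4 ∣ m)))
     ⊎ (((toℕ ℓ * toℕ k ≡[ n ] n / 2 + toℕ ℓ) ⊎ (toℕ ℓ * toℕ k + toℕ ℓ ≡[ n ] n / 2))
      × (m % 4 ≡ 2)
      × ((toℕ k * toℕ k ≡[ n ] n / 2 + 1) ⊎ (toℕ k * toℕ k + 1 ≡[ n ] n / 2)))) →
    SameGraph (Xa m n (toℕ k) (toℕ ℓ)) (Xa m n (n ∸ toℕ k) (toℕ ℓ))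
    × Iso (Xa m n (toℕ k) (toℕ ℓ)) (Xa m n (toℕ k) (n ∸ toℕ ℓ))
    × (4 ∣ n →
        (4 ∣ m → Iso (Xa m n (toℕ k) (toℕ ℓ)) (Xa m n (toℕ k + n / 2) (toℕ ℓ)))
        × (¬ (4 ∣ m) →
            Iso (Xa m n (toℕ k) (toℕ ℓ)) (Xa m n (toℕ k + n / 2) (toℕ ℓ + n / 2))))
lemma7p1 m n k ℓ _ 2∣m 2∣n _ k-odd _ _ _ _ =
  Xa-sameGraph m n (+-∸≈0 (<⇒≤ (toℕ<n k))) ,
  Reflection.reflectIso m n 2∣n (+-∸≈0 (<⇒≤ (toℕ<n ℓ))) ,
  twisted
  where
  open Modular n
  h L : ℕ
  h = n / 2
  L = toℕ ℓ

  h+h≡n : h + h ≡ n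
  h+h≡n = trans (cong (h +_) (sym (+-identityʳ h))) (m*[n/m]≡n 2∣n)

  twisted : 4 ∣ n → (4 ∣ m → Iso (Xa m n (toℕ k) L) (Xa m n (toℕ k + h) L))
                  × (¬ 4 ∣ m → Iso (Xa m n (toℕ k) L) (Xa m n (toℕ k + h) (L + h)))
  twisted 4∣n =
    (λ 4∣m → twistIso k-odd refl
               (trans (+-congˡ L (h*⌊m/2⌋≈0 4∣m)) (≡⇒≈ (+-identityʳ L)))) ,
    (λ 4∤m → twistIso k-odd refl (+-congˡ L (h*⌊m/2⌋≈h 4∤m)))
    where open Twist m n h 2∣m h+h≡n (m*n∣o⇒m∣o/n 2 2 4∣n)
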